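{- Let $z$ be an indeterminate and let $(N_{n,k}(z))$ be defined by $N_{0,0}=1$, $N_{0,k}=0$ ($k>0$), and for $n\ge1$, $N_{n,k}=N_{n-1,k-1}+(z+1)N_{n-1,k}+zN_{n-1,k+1}$ for all $k\ge0$ (with $N_{n-1,-1}=0$); so $N_{n,k}=0$ for $k>n$. Let $N_n(z)=N_{n,0}(z)$ (the Narayana polynomials). For any integers $n,r\ge0$ and $m\ge\ell\ge0$, with $M_r=\min\{n+r+1,m+r-\ell\}$, $$\sum_{k=0}^{M_r}z^k\det\begin{pmatrix}N_{n,k}(z)&N_{m,k+\ell+1}(z)\\ N_{n+r+1,k}(z)&N_{m+r+1,k+\ell+1}(z)\end{pmatrix}=\sum_{i=0}^{r}N_{n+i,0}(z)N_{m+r-i,\ell}(z).$$ In particular, for all $n,m\ge0$, $$\sum_{k=0}^{m}z^k\det\begin{pmatrix}N_{n,k}(z)&N_{m,k+1}(z)\\ N_{n+1,k}(z)&N_{m+1,k+1}(z)\end{pmatrix}=N_n(z)N_m(z).$$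
   Context: Explicitly, $N_n(z)=\sum_{i=0}^{n}\frac{1}{n+1}\binom{n+1}{i}\binom{n+1}{i+1}z^i$. -}

module Defs where

open import Level using (Level)
open import Data.Nat using (ℕ; zero; suc)
open import Algebra.Bundles using (CommutativeRing)

-- The polynomials N_{n,k}(z), evaluated at an element z of an arbitrary
-- commutative ring R.  (An identity of polynomials in Z[z] holds iff it holds
-- for every z in every commutative ring; take R = Z[z], z = the indeterminate.)
module Narayana {c ℓ : Level} (R : CommutativeRing c ℓ) (z : CommutativeRing.Carrier R) where
  open CommutativeRing R using (Carrier; _+_; _*_; _-_; 0#; 1#)

  N : ℕ → ℕ → Carrier
  N zero zero = 1#
  N zero (suc k) = 0#
  N (suc n) zero = ((z + 1#) * N n zero) + (z * N n 1)
  N (suc n) (suc k) = (N n k + ((z + 1#) * N n (suc k))) + (z * N n (suc (suc k)))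

  Nar : ℕ → Carrier
  Nar n = N n 0

  zpow : ℕ → Carrier
  zpow zero = 1#
  zpow (suc k) = z * zpow k

  sumTo : ℕ → (ℕ → Carrier) → Carrier
  sumTo zero f = f 0
  sumTo (suc M) f = sumTo M f + f (suc M)

  det2 : Carrier → Carrier → Carrier → Carrier → Carrier
  det2 a b c' d = (a * d) - (b * c')

{-# OPTIONS --safe #-}
-- Write J for the tridiagonal operator (J a)_k = a_{k-1} + (z+1) a_k + z a_{k+1} and
-- ⟨a, b⟩ = Σ_k z^k a_k b_k. The rows N_n = (N_{n,k})_k satisfy N_{n+1} = J N_n with a_{-1} = 0,
-- and the shifted rows S_m = (N_{m,k+l+1})_k satisfy S_{m+1} = J S_m with a_{-1} = N_{m,l}.
-- J is symmetric for ⟨_,_⟩ up to boundary terms (Lagrange's identity, telescoping the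
-- Casoratian); the upper boundary term vanishes because N_{n,k} = 0 for k > n, and the lower
-- one is N_{n,0} N_{m,l}. Hence ⟨N_n, S_{m+1}⟩ - ⟨N_{n+1}, S_m⟩ = N_{n,0} N_{m,l}, and the
-- determinant sum ⟨N_n, S_{m+r+1}⟩ - ⟨N_{n+r+1}, S_m⟩ telescopes in r. Its summands vanish
-- for k > M_r, so the sum may be taken over any range long enough for N_n to have died out.
module Submission where

open import Defs
open import Data.Nat using (ℕ; _≤_)
import Data.Nat as ℕ
open import Data.Product using (_×_)
open import Algebra.Bundles using (CommutativeRing)

open import Data.Nat using (zero; suc; _<_; _≤′_; ≤′-reflexive; ≤′-step; s≤s; z≤n)
import Data.Nat.Properties as ℕP
open import Data.Product using (_,_)
open import Data.Sum using (inj₁; inj₂)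
import Relation.Binary.PropositionalEquality as P
import Relation.Binary.Reasoning.Setoid as SetoidReasoning
import Algebra.Properties.Ring as RingProperties
import Algebra.Properties.CommutativeSemigroup as CommutativeSemigroupProperties

module NarayanaProperties {c ℓ} (R : CommutativeRing c ℓ) (z : CommutativeRing.Carrier R) where
  open CommutativeRing R
  open RingProperties ring using (-0#≈0#; -‿+-comm; x[y-z]≈xy-xz; ⁻¹-anti-homo‿-)
  open CommutativeSemigroupProperties +-commutativeSemigroup
    using () renaming (interchange to +-interchange)
  open Narayana R z
  open import Algebra.Solver.Ring.NaturalCoefficients.Default commutativeSemiring
  open SetoidReasoning setoid

  difference-of-zeros : ∀ {x y} → x ≈ 0# → y ≈ 0# → x - y ≈ 0#
  difference-of-zeros x≈0 y≈0 = trans (+-cong x≈0 (trans (-‿cong y≈0) -0#≈0#)) (+-identityʳ 0#)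

  x≈0⇒y*x≈0 : ∀ y {x} → x ≈ 0# → y * x ≈ 0#
  x≈0⇒y*x≈0 y x≈0 = trans (*-cong refl x≈0) (zeroʳ y)

  x≈0⇒x*y≈0 : ∀ y {x} → x ≈ 0# → x * y ≈ 0#
  x≈0⇒x*y≈0 y x≈0 = trans (*-cong x≈0 refl) (zeroˡ y)

  x-0≈x : ∀ x → x - 0# ≈ x
  x-0≈x x = trans (+-cong refl -0#≈0#) (+-identityʳ x)

  -- Reduces identities between differences to subtraction-free ones, which the semiring
  -- solver can decide.
  cross-difference : ∀ {a b c d} → a + d ≈ c + b → a - b ≈ c - d
  cross-difference {a} {b} {c} {d} a+d≈c+b = begin
    a - b                      ≈⟨ +-identityʳ _ ⟨
    (a - b) + 0#               ≈⟨ +-cong refl (-‿inverseʳ d) ⟨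
    (a + - b) + (d + - d)      ≈⟨ +-interchange a (- b) d (- d) ⟩
    (a + d) + (- b + - d)      ≈⟨ +-cong a+d≈c+b refl ⟩
    (c + b) + (- b + - d)      ≈⟨ regroup c b (- b) (- d) ⟩
    (c + - d) + (b + - b)      ≈⟨ +-cong refl (-‿inverseʳ b) ⟩
    (c - d) + 0#               ≈⟨ +-identityʳ _ ⟩
    c - d                      ∎
    where
    regroup : ∀ c b b′ d′ → (c + b) + (b′ + d′) ≈ (c + d′) + (b + b′)
    regroup = solve 4 (λ c b b′ d′ → (c :+ b) :+ (b′ :+ d′) := (c :+ d′) :+ (b :+ b′)) refl

  x-y+u-v≈x+u-[y+v] : ∀ x y u v → (x - y) + (u - v) ≈ (x + u) - (y + v)
  x-y+u-v≈x+u-[y+v] x y u v = trans (+-interchange x (- y) u (- v)) (+-cong refl (-‿+-comm y v))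

  [x-y]-[u-v]≈x+v-[y+u] : ∀ x y u v → (x - y) - (u - v) ≈ (x + v) - (y + u)
  [x-y]-[u-v]≈x+v-[y+u] x y u v =
    trans (+-cong refl (⁻¹-anti-homo‿- u v)) (x-y+u-v≈x+u-[y+v] x y v u)

  sumTo-cong : ∀ K {f g : ℕ → Carrier} → (∀ k → k ≤ K → f k ≈ g k) → sumTo K f ≈ sumTo K g
  sumTo-cong zero    f≈g = f≈g 0 z≤n
  sumTo-cong (suc K) f≈g =
    +-cong (sumTo-cong K (λ k k≤K → f≈g k (ℕP.m≤n⇒m≤1+n k≤K))) (f≈g (suc K) ℕP.≤-refl)

  sumTo-− : ∀ K (f g : ℕ → Carrier) → sumTo K (λ k → f k - g k) ≈ sumTo K f - sumTo K g
  sumTo-− zero    f g = refl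
  sumTo-− (suc K) f g = trans (+-cong (sumTo-− K f g) refl) (x-y+u-v≈x+u-[y+v] _ _ _ _)

  sumTo-telescope : ∀ K (g : ℕ → Carrier) → sumTo K (λ k → g k - g (suc k)) ≈ g 0 - g (suc K)
  sumTo-telescope zero    g = refl
  sumTo-telescope (suc K) g =
    trans (+-cong (sumTo-telescope K g) refl)
          (trans (x-y+u-v≈x+u-[y+v] _ _ _ _) (cross-difference (+-assoc _ _ _)))

  sumTo-vanishing-tail : ∀ {K L} (f : ℕ → Carrier) → (∀ k → K < k → f k ≈ 0#) → K ≤ L →
                         sumTo L f ≈ sumTo K f
  sumTo-vanishing-tail {K} f f≈0 K≤L = extend (ℕP.≤⇒≤′ K≤L)
    where
    extend : ∀ {L} → K ≤′ L → sumTo L f ≈ sumTo K f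
    extend (≤′-reflexive P.refl) = refl
    extend (≤′-step K≤′L) =
      trans (+-cong (extend K≤′L) (f≈0 _ (s≤s (ℕP.≤′⇒≤ K≤′L)))) (+-identityʳ _)

  inner : ℕ → (ℕ → Carrier) → (ℕ → Carrier) → Carrier
  inner K a b = sumTo K (λ k → zpow k * (a k * b k))

  inner-cong : ∀ K {a a′ b b′ : ℕ → Carrier} → (∀ k → a k ≈ a′ k) → (∀ k → b k ≈ b′ k) →
               inner K a b ≈ inner K a′ b′
  inner-cong K a≈a′ b≈b′ = sumTo-cong K (λ k _ → *-cong refl (*-cong (a≈a′ k) (b≈b′ k)))

  sumTo-det2 : ∀ K (a b c d : ℕ → Carrier) →
               sumTo K (λ k → zpow k * det2 (a k) (b k) (c k) (d k)) ≈ inner K a d - inner K c b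
  sumTo-det2 K a b c d = trans (sumTo-cong K (λ k _ → expand k)) (sumTo-− K _ _)
    where
    expand : ∀ k → zpow k * det2 (a k) (b k) (c k) (d k)
                   ≈ zpow k * (a k * d k) - zpow k * (c k * b k)
    expand k = trans (x[y-z]≈xy-xz _ _ _) (+-cong refl (-‿cong (*-cong refl (*-comm _ _))))

  det2-zero-columnˡ : ∀ {A B C D} → A ≈ 0# → C ≈ 0# → det2 A B C D ≈ 0#
  det2-zero-columnˡ A≈0 C≈0 = difference-of-zeros (x≈0⇒x*y≈0 _ A≈0) (x≈0⇒y*x≈0 _ C≈0)

  det2-zero-columnʳ : ∀ {A B C D} → B ≈ 0# → D ≈ 0# → det2 A B C D ≈ 0#
  det2-zero-columnʳ B≈0 D≈0 = difference-of-zeros (x≈0⇒y*x≈0 _ D≈0) (x≈0⇒x*y≈0 _ B≈0)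

  -- prepend α a k is a_{k-1}, with the convention a_{-1} = α.
  prepend : Carrier → (ℕ → Carrier) → ℕ → Carrier
  prepend α a zero    = α
  prepend α a (suc k) = a k

  jacobi : Carrier → (ℕ → Carrier) → ℕ → Carrier
  jacobi α a k = (prepend α a k + (z + 1#) * a k) + z * a (suc k)

  casoratian : Carrier → Carrier → (ℕ → Carrier) → (ℕ → Carrier) → ℕ → Carrier
  casoratian α β a b k = zpow k * (a k * prepend β b k) - zpow k * (prepend α a k * b k)

  lagrange : ∀ α β a b k →
             zpow k * (a k * jacobi β b k) - zpow k * (jacobi α a k * b k)
             ≈ casoratian α β a b k - casoratian α β a b (suc k)
  lagrange α β a b k =
    trans (cross-difference (expand (zpow k) z (z + 1#) (prepend α a k) (prepend β b k)
                                    (a k) (a (suc k)) (b k) (b (suc k))))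
          (sym ([x-y]-[u-v]≈x+v-[y+u] _ _ _ _))
    where
    expand : ∀ t z w p q x x′ y y′ →
             t * (x * ((q + w * y) + z * y′)) + (t * (p * y) + (z * t) * (x′ * y))
             ≈ (t * (x * q) + (z * t) * (x * y′)) + t * (((p + w * x) + z * x′) * y)
    expand = solve 9 (λ t z w p q x x′ y y′ →
      t :* (x :* ((q :+ w :* y) :+ z :* y′)) :+ (t :* (p :* y) :+ (z :* t) :* (x′ :* y))
      := (t :* (x :* q) :+ (z :* t) :* (x :* y′)) :+ t :* (((p :+ w :* x) :+ z :* x′) :* y)) refl

  green : ∀ α β a b K →
          inner K a (jacobi β b) - inner K (jacobi α a) b
          ≈ casoratian α β a b 0 - casoratian α β a b (suc K)
  green α β a b K = begin
    inner K a (jacobi β b) - inner K (jacobi α a) b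
      ≈⟨ sumTo-− K _ _ ⟨
    sumTo K (λ k → zpow k * (a k * jacobi β b k) - zpow k * (jacobi α a k * b k))
      ≈⟨ sumTo-cong K (λ k _ → lagrange α β a b k) ⟩
    sumTo K (λ k → casoratian α β a b k - casoratian α β a b (suc k))
      ≈⟨ sumTo-telescope K (casoratian α β a b) ⟩
    casoratian α β a b 0 - casoratian α β a b (suc K) ∎

  casoratian-0 : ∀ β a b → casoratian 0# β a b 0 ≈ a 0 * β
  casoratian-0 β a b =
    trans (+-cong (*-identityˡ _) (-‿cong (trans (*-identityˡ _) (zeroˡ _)))) (x-0≈x _)

  casoratian-vanishing : ∀ α β a b K → a K ≈ 0# → a (suc K) ≈ 0# →
                         casoratian α β a b (suc K) ≈ 0#
  casoratian-vanishing α β a b K aK≈0 aK+1≈0 =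
    difference-of-zeros (x≈0⇒y*x≈0 _ (x≈0⇒x*y≈0 _ aK+1≈0)) (x≈0⇒y*x≈0 _ (x≈0⇒x*y≈0 _ aK≈0))

  N-vanishing : ∀ {n k} → n < k → N n k ≈ 0#
  N-vanishing {zero}  {suc k} _          = refl
  N-vanishing {suc n} {suc k} (s≤s n<k) =
    trans (+-cong (+-cong (N-vanishing n<k) (x≈0⇒y*x≈0 _ (N-vanishing n<1+k)))
                  (x≈0⇒y*x≈0 z (N-vanishing (ℕP.m<n⇒m<1+n n<1+k))))
          (trans (+-identityʳ _) (+-identityʳ _))
    where
    n<1+k : n < suc k
    n<1+k = ℕP.m<n⇒m<1+n n<k

  N-suc≈jacobi : ∀ n k → N (suc n) k ≈ jacobi 0# (N n) k
  N-suc≈jacobi n zero    = +-cong (sym (+-identityˡ _)) refl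
  N-suc≈jacobi n (suc k) = refl

  shiftN : ℕ → ℕ → ℕ → Carrier
  shiftN l m k = N m (suc (k ℕ.+ l))

  shiftN-suc≈jacobi : ∀ l m k → shiftN l (suc m) k ≈ jacobi (N m l) (shiftN l m) k
  shiftN-suc≈jacobi l m zero    = refl
  shiftN-suc≈jacobi l m (suc k) = refl

  inner-step : ∀ {K n} m l → n < K →
               inner K (N n) (shiftN l (suc m)) - inner K (N (suc n)) (shiftN l m) ≈ N n 0 * N m l
  inner-step {K} {n} m l n<K = begin
    inner K (N n) (shiftN l (suc m)) - inner K (N (suc n)) (shiftN l m)
      ≈⟨ +-cong (inner-cong K (λ _ → refl) (shiftN-suc≈jacobi l m))
                (-‿cong (inner-cong K (N-suc≈jacobi n) (λ _ → refl))) ⟩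
    inner K (N n) (jacobi (N m l) (shiftN l m)) - inner K (jacobi 0# (N n)) (shiftN l m)
      ≈⟨ green 0# (N m l) (N n) (shiftN l m) K ⟩
    casoratian 0# (N m l) (N n) (shiftN l m) 0 - casoratian 0# (N m l) (N n) (shiftN l m) (suc K)
      ≈⟨ +-cong (casoratian-0 (N m l) (N n) (shiftN l m))
                (-‿cong (casoratian-vanishing 0# (N m l) (N n) (shiftN l m) K
                                              (N-vanishing n<K) (N-vanishing (ℕP.m<n⇒m<1+n n<K)))) ⟩
    N n 0 * N m l - 0#
      ≈⟨ x-0≈x _ ⟩
    N n 0 * N m l ∎

  det-term : ℕ → ℕ → ℕ → ℕ → ℕ → Carrier
  det-term n r m l k =
    zpow k * det2 (N n k) (shiftN l m k) (N (suc (n ℕ.+ r)) k) (shiftN l (suc (m ℕ.+ r)) k)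

  det-sum-telescope : ∀ n r m l {K} → n ℕ.+ r < K →
    sumTo K (det-term n r m l) ≈ sumTo r (λ i → N (n ℕ.+ i) 0 * N ((m ℕ.+ r) ℕ.∸ i) l)
  det-sum-telescope n r m l {K} n+r<K = begin
    sumTo K (det-term n r m l)
      ≈⟨ sumTo-det2 K _ _ _ _ ⟩
    inner K (N n) (shiftN l (suc (m ℕ.+ r))) - inner K (N (suc (n ℕ.+ r))) (shiftN l m)
      ≈⟨ reflexive (P.cong₂ _-_ (P.cong (λ t → inner K (N t) _) (P.sym (ℕP.+-identityʳ n)))
                                (P.cong₂ (λ s t → inner K (N s) (shiftN l t))
                                         (P.sym (ℕP.+-suc n r)) (P.sym (ℕP.m+n∸n≡m m r)))) ⟩
    G 0 - G (suc r)
      ≈⟨ sumTo-telescope r G ⟨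
    sumTo r (λ i → G i - G (suc i))
      ≈⟨ sumTo-cong r step ⟩
    sumTo r (λ i → N (n ℕ.+ i) 0 * N ((m ℕ.+ r) ℕ.∸ i) l) ∎
    where
    G : ℕ → Carrier
    G i = inner K (N (n ℕ.+ i)) (shiftN l (suc (m ℕ.+ r) ℕ.∸ i))
    step : ∀ i → i ≤ r → G i - G (suc i) ≈ N (n ℕ.+ i) 0 * N ((m ℕ.+ r) ℕ.∸ i) l
    step i i≤r rewrite ℕP.+-∸-assoc 1 (ℕP.≤-trans i≤r (ℕP.m≤n+m r m)) | ℕP.+-suc n i =
      inner-step ((m ℕ.+ r) ℕ.∸ i) l (ℕP.≤-<-trans (ℕP.+-monoʳ-≤ n i≤r) n+r<K)

  det-term-vanishing : ∀ n r m l {k} → l ≤ m → (n ℕ.+ r ℕ.+ 1) ℕ.⊓ ((m ℕ.+ r) ℕ.∸ l) < k →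
                       det-term n r m l k ≈ 0#
  det-term-vanishing n r m l {k} l≤m M<k with ℕP.⊓-sel (n ℕ.+ r ℕ.+ 1) ((m ℕ.+ r) ℕ.∸ l)
  ... | inj₁ M≡n+r+1 =
    x≈0⇒y*x≈0 (zpow k) (det2-zero-columnˡ (N-vanishing n<k) (N-vanishing n+r+1<k))
    where
    n+r+1<k : suc (n ℕ.+ r) < k
    n+r+1<k = P.subst (_< k) (P.trans M≡n+r+1 (ℕP.+-comm (n ℕ.+ r) 1)) M<k
    n<k : n < k
    n<k = ℕP.<-trans (s≤s (ℕP.m≤m+n n r)) n+r+1<k
  ... | inj₂ M≡m+r-l =
    x≈0⇒y*x≈0 (zpow k) (det2-zero-columnʳ (N-vanishing m<1+k+l) (N-vanishing (s≤s m+r<k+l)))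
    where
    m+r<k+l : m ℕ.+ r < k ℕ.+ l
    m+r<k+l = P.subst (_< k ℕ.+ l) (ℕP.m∸n+n≡m (ℕP.≤-trans l≤m (ℕP.m≤m+n m r)))
                      (ℕP.+-monoˡ-< l (P.subst (_< k) M≡m+r-l M<k))
    m<1+k+l : m < suc (k ℕ.+ l)
    m<1+k+l = ℕP.m<n⇒m<1+n (ℕP.≤-<-trans (ℕP.m≤m+n m r) m+r<k+l)

  det-sum : ∀ n r m l K → l ≤ m → (n ℕ.+ r ℕ.+ 1) ℕ.⊓ ((m ℕ.+ r) ℕ.∸ l) ≤ K →
    sumTo K (λ k → zpow k * det2 (N n k) (N m (k ℕ.+ l ℕ.+ 1)) (N (n ℕ.+ r ℕ.+ 1) k) (N (m ℕ.+ r ℕ.+ 1) (k ℕ.+ l ℕ.+ 1)))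
    ≈ sumTo r (λ i → N (n ℕ.+ i) 0 * N ((m ℕ.+ r) ℕ.∸ i) l)
  det-sum n r m l K l≤m M≤K = begin
    sumTo K (λ k → zpow k * det2 (N n k) (N m (k ℕ.+ l ℕ.+ 1)) (N (n ℕ.+ r ℕ.+ 1) k) (N (m ℕ.+ r ℕ.+ 1) (k ℕ.+ l ℕ.+ 1)))
      ≈⟨ sumTo-cong K (λ k _ → reflexive (+1≡suc k)) ⟩
    sumTo K (det-term n r m l)
      ≈⟨ sumTo-vanishing-tail (det-term n r m l)
           (λ k K<k → det-term-vanishing n r m l l≤m (ℕP.≤-<-trans M≤K K<k))
           (ℕP.m≤m+n K (suc (n ℕ.+ r))) ⟨
    sumTo (K ℕ.+ suc (n ℕ.+ r)) (det-term n r m l)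
      ≈⟨ det-sum-telescope n r m l (ℕP.m≤n+m (suc (n ℕ.+ r)) K) ⟩
    sumTo r (λ i → N (n ℕ.+ i) 0 * N ((m ℕ.+ r) ℕ.∸ i) l) ∎
    where
    +1≡suc : ∀ k →
      zpow k * det2 (N n k) (N m (k ℕ.+ l ℕ.+ 1)) (N (n ℕ.+ r ℕ.+ 1) k) (N (m ℕ.+ r ℕ.+ 1) (k ℕ.+ l ℕ.+ 1))
      P.≡ det-term n r m l k
    +1≡suc k rewrite ℕP.+-comm (k ℕ.+ l) 1 | ℕP.+-comm (n ℕ.+ r) 1 | ℕP.+-comm (m ℕ.+ r) 1 = P.refl

  narayana-product : ∀ n m →
    sumTo m (λ k → zpow k * det2 (N n k) (N m (k ℕ.+ 1)) (N (n ℕ.+ 1) k) (N (m ℕ.+ 1) (k ℕ.+ 1)))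
    ≈ Nar n * Nar m
  narayana-product n m = begin
    sumTo m (λ k → zpow k * det2 (N n k) (N m (k ℕ.+ 1)) (N (n ℕ.+ 1) k) (N (m ℕ.+ 1) (k ℕ.+ 1)))
      ≈⟨ sumTo-cong m (λ k _ → reflexive (drop-zeros k)) ⟩
    sumTo m (λ k → zpow k * det2 (N n k) (N m (k ℕ.+ 0 ℕ.+ 1)) (N (n ℕ.+ 0 ℕ.+ 1) k)
                                  (N (m ℕ.+ 0 ℕ.+ 1) (k ℕ.+ 0 ℕ.+ 1)))
      ≈⟨ det-sum n 0 m 0 m z≤n (ℕP.≤-trans (ℕP.m⊓n≤n _ _) (ℕP.≤-reflexive (ℕP.+-identityʳ m))) ⟩
    N (n ℕ.+ 0) 0 * N (m ℕ.+ 0) 0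
      ≈⟨ reflexive (P.cong₂ (λ s t → N s 0 * N t 0) (ℕP.+-identityʳ n) (ℕP.+-identityʳ m)) ⟩
    Nar n * Nar m ∎
    where
    drop-zeros : ∀ k →
      zpow k * det2 (N n k) (N m (k ℕ.+ 1)) (N (n ℕ.+ 1) k) (N (m ℕ.+ 1) (k ℕ.+ 1))
      P.≡ zpow k * det2 (N n k) (N m (k ℕ.+ 0 ℕ.+ 1)) (N (n ℕ.+ 0 ℕ.+ 1) k)
                        (N (m ℕ.+ 0 ℕ.+ 1) (k ℕ.+ 0 ℕ.+ 1))
    drop-zeros k rewrite ℕP.+-identityʳ k | ℕP.+-identityʳ n | ℕP.+-identityʳ m = P.refl

corollary3p3 : ∀ {c ℓ} (R : CommutativeRing c ℓ) (z : CommutativeRing.Carrier R) →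
    let open CommutativeRing R in
    let open Narayana R z in
    (∀ (n r m l : ℕ) → l ≤ m →
      sumTo ((n ℕ.+ r ℕ.+ 1) ℕ.⊓ ((m ℕ.+ r) ℕ.∸ l))
        (λ k → zpow k * det2 (N n k) (N m (k ℕ.+ l ℕ.+ 1)) (N (n ℕ.+ r ℕ.+ 1) k) (N (m ℕ.+ r ℕ.+ 1) (k ℕ.+ l ℕ.+ 1)))
      ≈ sumTo r (λ i → N (n ℕ.+ i) 0 * N ((m ℕ.+ r) ℕ.∸ i) l))
    × (∀ (n m : ℕ) →
      sumTo m (λ k → zpow k * det2 (N n k) (N m (k ℕ.+ 1)) (N (n ℕ.+ 1) k) (N (m ℕ.+ 1) (k ℕ.+ 1)))
      ≈ (Nar n * Nar m))
corollary3p3 R z = (λ n r m l l≤m → det-sum n r m l _ l≤m ℕP.≤-refl) , narayana-product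
  where open NarayanaProperties R z
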